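{- Let $\mathbf{T}=(\beta_n)_{n\in\mathbb{N}}=23323223322323322\cdots$ be the Thue--Morse word over $\{2,3\}$ starting with $2$, i.e., the fixed point starting with $2$ of the morphism $\tau\colon 2\mapsto 23,\ 3\mapsto 32$, viewed as a Cantor real base. For every $r\in[0,1)$, if $d_6(r)=c_0c_1c_2\cdots$ is the greedy $6$-expansion of $r$, then the greedy $\mathbf{T}$-expansion of $r$ is \[ d_{\mathbf{T}}(r)=h_{\beta_0}(c_0)h_{\beta_1}(c_1)h_{\beta_2}(c_2)\cdots = h_2(c_0)h_3(c_1)h_3(c_2)h_2(c_3)\cdots .\]
   Context: A Cantor real base is a sequence $\mathbf{B}=(\beta_n)_{n\in\mathbb{N}}$ of reals $>1$ with $\prod_n\beta_n=+\infty$. For $r\in[0,1]$, the greedy $\mathbf{B}$-expansion $d_{\mathbf{B}}(r)=(a_n)_{n\in\mathbb{N}}$ is defined by: having chosen $a_0,\ldots,a_{N-1}$, the digit $a_N$ is the largest integer such that $\sum_{n=0}^N a_n/(\beta_0\cdots\beta_n)\le r$. For a constant base $\beta$ this is the usual greedy $\beta$-expansion $d_\beta(r)$. The morphisms $h_2,h_3\colon\{0,\ldots,5\}^*\to\{0,1,2\}^*$ are defined as follows: writing $c=3a+b$ with $a\in\{0,1\}$, $b\in\{0,1,2\}$, set $h_2(c)=ab$; writing $c=2a+b$ with $a\in\{0,1,2\}$, $b\in\{0,1\}$, set $h_3(c)=ab$. Explicitly $h_2\colon 0\mapsto 00,1\mapsto 01,2\mapsto 02,3\mapsto 10,4\mapsto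 11,5\mapsto 12$ and $h_3\colon 0\mapsto 00,1\mapsto 01,2\mapsto 10,3\mapsto 11,4\mapsto 20,5\mapsto 21$. -}

module Defs where

open import Data.Nat as ℕ using (ℕ; zero; suc)
open import Data.Nat.DivMod using (_/_; _%_)
open import Data.List using (List; []; _∷_; concatMap)
open import Data.Product using (_×_; _,_; ∃; Σ)
open import Relation.Binary.PropositionalEquality using (_≡_; _≢_)
open import Relation.Binary.Structures using (IsTotalOrder)
open import Algebra.Structures using (IsCommutativeRing)
open import Function using (_∘_)

-- The real numbers, given axiomatically as a complete ordered field
-- (any model is isomorphic to ℝ).  Equality is propositional equality.

record CompleteOrderedField : Set₁ where
  infixl 6 _+_
  infixl 7 _*_
  infix 4 _≤_ _<_
  field
    R       : Set
    _+_ _*_ : R → R → R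
    -_      : R → R
    0# 1#   : R
    isCommutativeRing : IsCommutativeRing _≡_ _+_ _*_ -_ 0# 1#
    _⁻¹     : R → R
    ⁻¹-inverse : ∀ x → x ≢ 0# → x * (x ⁻¹) ≡ 1#
    0≢1     : 0# ≢ 1#
    _≤_     : R → R → Set
    isTotalOrder : IsTotalOrder _≡_ _≤_
    +-mono-≤ : ∀ x y z → x ≤ y → x + z ≤ y + z
    *-nonneg : ∀ x y → 0# ≤ x → 0# ≤ y → 0# ≤ x * y
    complete : (S : R → Set) → ∃ S → (∃ λ b → ∀ x → S x → x ≤ b) →
               ∃ λ s → (∀ x → S x → x ≤ s) × (∀ b → (∀ x → S x → x ≤ b) → s ≤ b)

  _<_ : R → R → Set
  x < y = (x ≤ y) × (x ≢ y)

  fromℕ : ℕ → R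
  fromℕ zero    = 0#
  fromℕ (suc n) = 1# + fromℕ n

P : (ℕ → ℕ) → ℕ → ℕ
P β zero    = β 0
P β (suc n) = P β n ℕ.* β (suc n)

module _ (F : CompleteOrderedField) where
  open CompleteOrderedField F

  partialSum : (ℕ → ℕ) → (ℕ → ℕ) → ℕ → R
  partialSum β a zero    = 0#
  partialSum β a (suc N) = partialSum β a N + fromℕ (a N) * (fromℕ (P β N)) ⁻¹

  -- a is the greedy β-expansion of r: for every N, a N is the largest
  -- integer m with  Σ_{n<N} a n/(β0⋯βn) + m/(β0⋯βN) ≤ r.
  -- (That largest integer is ≥ 0, as the previous partial sum is ≤ r,
  --  so digits are taken in ℕ.)
  IsGreedyExpansion : (ℕ → ℕ) → R → (ℕ → ℕ) → Set
  IsGreedyExpansion β r a =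
    ∀ N → (partialSum β a N + fromℕ (a N) * (fromℕ (P β N)) ⁻¹ ≤ r)
        × (∀ (m : ℕ) → partialSum β a N + fromℕ m * (fromℕ (P β N)) ⁻¹ ≤ r → m ℕ.≤ a N)

-- Thue–Morse word over {2,3} starting with 2: fixed point of
-- τ : 2 ↦ 23, 3 ↦ 32.  β n is the n-th letter of τ^(n+1)(2), which has
-- length 2^(n+1) > n and is a prefix of the fixed point.

τ : ℕ → List ℕ
τ 2 = 2 ∷ 3 ∷ []
τ 3 = 3 ∷ 2 ∷ []
τ _ = []

τ* : List ℕ → List ℕ
τ* = concatMap τ

iterate : ℕ → List ℕ → List ℕ
iterate zero    w = w
iterate (suc k) w = τ* (iterate k w)

nth : ℕ → List ℕ → ℕ
nth _       []       = 0
nth zero    (x ∷ _)  = x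
nth (suc n) (_ ∷ xs) = nth n xs

thueMorse : ℕ → ℕ
thueMorse n = nth n (iterate (suc n) (2 ∷ []))

six : ℕ → ℕ
six _ = 6

h : ℕ → ℕ → ℕ × ℕ
h 2 c = (c / 3 , c % 3)
h 3 c = (c / 2 , c % 2)
h _ c = (0 , 0)

{-# OPTIONS --safe #-}
module Submission where

-- Since β₂ₙβ₂ₙ₊₁ = τ(βₙ) ∈ {23, 32}, consecutive pairs of Thue–Morse bases
-- multiply to 6, so β₀⋯β₂ₙ₊₁ = 6ⁿ⁺¹: after every even number of digits the
-- T-expansion and the 6-expansion use the same denominator.  If their partial
-- sums agree there, the next two greedy T-digits x, y satisfy
-- x·β₂ₙ₊₁ + y = cₙ with y < β₂ₙ₊₁ (x·β₂ₙ₊₁ + y is again greedy for the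
-- denominator 6ⁿ⁺¹, and y ≥ β₂ₙ₊₁ would contradict the maximality of x),
-- and the partial sums agree again.  So (x, y) is cₙ divided with remainder
-- by β₂ₙ₊₁ = 5 − βₙ, which is h_{βₙ}(cₙ).

open import Defs
open import Data.Nat.Base as ℕ using (ℕ; zero; suc; NonZero)
open import Data.Product using (_×_; _,_; proj₁; proj₂)
open import Data.Sum using (_⊎_; inj₁; inj₂)
open import Function using (_∘_)
open import Relation.Binary.PropositionalEquality
  using (_≡_; _≢_; refl; sym; trans; cong; cong₂; subst; subst₂; module ≡-Reasoning)

module BasesAndDigits where

  open import Data.Nat.Base using (_+_; _*_; _<_)
  open import Data.Nat.Properties using (*-suc; *-assoc; +-comm; +-identityʳ; m*n≢0)
  open import Data.Nat.DivMod using (_/_; _%_; +-distrib-/-∣ˡ; m*n/n≡m; m<n⇒m/n≡0; [m+kn]%n≡m%n; m<n⇒m%n≡m)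
  open import Data.Nat.Divisibility using (divides-refl)

  P-nonZero : ∀ {β} → (∀ n → NonZero (β n)) → ∀ N → NonZero (P β N)
  P-nonZero β≢0 zero    = β≢0 0
  P-nonZero β≢0 (suc N) = m*n≢0 _ _ {{P-nonZero β≢0 N}} {{β≢0 (suc N)}}

  P-grouped : ∀ {β γ} → (∀ n → β (2 * n) * β (suc (2 * n)) ≡ γ n) → ∀ n → P β (suc (2 * n)) ≡ P γ n
  P-grouped pairs zero    = pairs 0
  P-grouped {β} {γ} pairs (suc n) = begin
    P β (suc (2 * suc n))                                    ≡⟨ cong (P β ∘ suc) (*-suc 2 n) ⟩
    P β (suc (2 * n)) * β (2 + 2 * n) * β (3 + 2 * n)        ≡⟨ *-assoc (P β (suc (2 * n))) _ _ ⟩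
    P β (suc (2 * n)) * (β (2 + 2 * n) * β (3 + 2 * n))      ≡⟨ cong₂ _*_ (P-grouped pairs n) next-pair ⟩
    P γ n * γ (suc n)                                        ∎
    where
    open ≡-Reasoning
    next-pair : β (2 + 2 * n) * β (3 + 2 * n) ≡ γ (suc n)
    next-pair = subst (λ k → β k * β (suc k) ≡ γ (suc n)) (*-suc 2 n) (pairs (suc n))

  IsDivMod : ℕ → ℕ → ℕ → ℕ → Set
  IsDivMod z p x y = (x * p + y ≡ z) × (y < p)

  divMod-unique : ∀ {z p x y} .{{_ : NonZero p}} → IsDivMod z p x y → (x , y) ≡ (z / p , z % p)
  divMod-unique {p = p} {x} {y} (refl , y<p) = cong₂ _,_ (sym quotient) (sym remainder)
    where
    open ≡-Reasoning
    quotient : (x * p + y) / p ≡ x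
    quotient = begin
      (x * p + y) / p        ≡⟨ +-distrib-/-∣ˡ y (divides-refl x) ⟩
      x * p / p + y / p      ≡⟨ cong₂ _+_ (m*n/n≡m x p) (m<n⇒m/n≡0 y<p) ⟩
      x + 0                  ≡⟨ +-identityʳ x ⟩
      x                      ∎
    remainder : (x * p + y) % p ≡ y
    remainder = begin
      (x * p + y) % p        ≡⟨ cong (_% p) (+-comm (x * p) y) ⟩
      (y + x * p) % p        ≡⟨ [m+kn]%n≡m%n y x p ⟩
      y % p                  ≡⟨ m<n⇒m%n≡m y<p ⟩
      y                      ∎

module ThueMorse where

  open import Data.Nat.Base using (_+_; _*_; _∸_; _<_; _<′_; ≤′-refl; ≤′-step; s≤s; z<s; s<s)
  open import Data.Nat.Properties using (+-suc; +-mono-≤-<; ≤-trans; <-trans; <⇒<′; <′⇒<; n<1+n; m<n⇒m<1+n; m≤m+n)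
  open BasesAndDigits using (IsDivMod; divMod-unique)
  open import Data.List using (List; []; _∷_; _++_; length)
  open import Data.List.Properties using (concatMap-++)
  open import Data.List.Relation.Unary.All using (All; []; _∷_)

  Is2or3 : ℕ → Set
  Is2or3 x = x ≡ 2 ⊎ x ≡ 3

  τ*-all : ∀ {w} → All Is2or3 w → All Is2or3 (τ* w)
  τ*-all []               = []
  τ*-all (inj₁ refl ∷ ps) = inj₁ refl ∷ inj₂ refl ∷ τ*-all ps
  τ*-all (inj₂ refl ∷ ps) = inj₂ refl ∷ inj₁ refl ∷ τ*-all ps

  length-τ* : ∀ {w} → All Is2or3 w → length (τ* w) ≡ length w + length w
  length-τ* []                       = refl
  length-τ* {_ ∷ w} (inj₁ refl ∷ ps) = cong suc (trans (cong suc (length-τ* ps)) (sym (+-suc (length w) (length w))))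
  length-τ* {_ ∷ w} (inj₂ refl ∷ ps) = cong suc (trans (cong suc (length-τ* ps)) (sym (+-suc (length w) (length w))))

  nth-τ* : ∀ {w} → All Is2or3 w → ∀ {i} → i < length w →
           (nth (2 * i) (τ* w) ≡ nth i w) × (nth (suc (2 * i)) (τ* w) ≡ 5 ∸ nth i w)
  nth-τ* (inj₁ refl ∷ _)  {zero}  _          = refl , refl
  nth-τ* (inj₂ refl ∷ _)  {zero}  _          = refl , refl
  -- 2 * suc i normalises to suc (i + suc (i + 0)).
  nth-τ* (inj₁ refl ∷ ps) {suc i} (s<s i<w) rewrite +-suc i (i + 0) = nth-τ* ps i<w
  nth-τ* (inj₂ refl ∷ ps) {suc i} (s<s i<w) rewrite +-suc i (i + 0) = nth-τ* ps i<w

  nth-All : ∀ {P : ℕ → Set} {w} → All P w → ∀ {i} → i < length w → P (nth i w)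
  nth-All (p ∷ _)  {zero}  _         = p
  nth-All (_ ∷ ps) {suc i} (s<s i<w) = nth-All ps i<w

  nth-++ˡ : ∀ xs {ys i} → i < length xs → nth i (xs ++ ys) ≡ nth i xs
  nth-++ˡ (_ ∷ _)  {i = zero}  _         = refl
  nth-++ˡ (_ ∷ xs) {i = suc i} (s<s i<xs) = nth-++ˡ xs i<xs

  iterate-suc : ∀ k w → iterate (suc k) w ≡ iterate k (τ* w)
  iterate-suc zero    w = refl
  iterate-suc (suc k) w = cong τ* (iterate-suc k w)

  iterate-++ : ∀ k xs ys → iterate k (xs ++ ys) ≡ iterate k xs ++ iterate k ys
  iterate-++ zero    xs ys = refl
  iterate-++ (suc k) xs ys =
    trans (cong τ* (iterate-++ k xs ys)) (concatMap-++ τ (iterate k xs) (iterate k ys))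

  tmPrefix : ℕ → List ℕ
  tmPrefix k = iterate k (2 ∷ [])

  tmPrefix-all : ∀ k → All Is2or3 (tmPrefix k)
  tmPrefix-all zero    = inj₁ refl ∷ []
  tmPrefix-all (suc k) = τ*-all (tmPrefix-all k)

  k<length-tmPrefix : ∀ k → k < length (tmPrefix k)
  k<length-tmPrefix zero    = z<s
  k<length-tmPrefix (suc k) =
    subst (suc k <_) (sym (length-τ* (tmPrefix-all k))) (+-mono-≤-< (≤-trans z<s ih) ih)
    where
    ih : k < length (tmPrefix k)
    ih = k<length-tmPrefix k

  nth-tmPrefix-suc : ∀ {i} k → i < length (tmPrefix k) → nth i (tmPrefix (suc k)) ≡ nth i (tmPrefix k)
  nth-tmPrefix-suc k i<len = begin
    nth _ (tmPrefix (suc k))                          ≡⟨ cong (nth _) (iterate-suc k (2 ∷ [])) ⟩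
    nth _ (iterate k ((2 ∷ []) ++ (3 ∷ [])))          ≡⟨ cong (nth _) (iterate-++ k (2 ∷ []) (3 ∷ [])) ⟩
    nth _ (tmPrefix k ++ iterate k (3 ∷ []))          ≡⟨ nth-++ˡ (tmPrefix k) i<len ⟩
    nth _ (tmPrefix k)                                ∎
    where open ≡-Reasoning

  nth-tmPrefix : ∀ k {n} → n < k → nth n (tmPrefix k) ≡ thueMorse n
  nth-tmPrefix _ n<k = stable (<⇒<′ n<k)
    where
    stable : ∀ {n k} → n <′ k → nth n (tmPrefix k) ≡ thueMorse n
    stable ≤′-refl                  = refl
    stable (≤′-step {k} n<′k) =
      trans (nth-tmPrefix-suc k (<-trans (<′⇒< n<′k) (k<length-tmPrefix k))) (stable n<′k)

  thueMorse-2or3 : ∀ n → Is2or3 (thueMorse n)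
  thueMorse-2or3 n = nth-All (tmPrefix-all (suc n)) (<-trans (n<1+n n) (k<length-tmPrefix (suc n)))

  thueMorse-doubling : ∀ n → (thueMorse (2 * n) ≡ thueMorse n) × (thueMorse (suc (2 * n)) ≡ 5 ∸ thueMorse n)
  thueMorse-doubling n = even , odd
    where
    open ≡-Reasoning
    w : List ℕ
    w = tmPrefix (suc (2 * n))
    n<2n+1 : n < suc (2 * n)
    n<2n+1 = s≤s (m≤m+n n _)
    nth-τ*w : (nth (2 * n) (τ* w) ≡ nth n w) × (nth (suc (2 * n)) (τ* w) ≡ 5 ∸ nth n w)
    nth-τ*w = nth-τ* (tmPrefix-all (suc (2 * n))) (<-trans n<2n+1 (k<length-tmPrefix _))

    even : thueMorse (2 * n) ≡ thueMorse n
    even = begin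
      thueMorse (2 * n)    ≡⟨ nth-tmPrefix (suc (suc (2 * n))) (m<n⇒m<1+n (n<1+n _)) ⟨
      nth (2 * n) (τ* w)   ≡⟨ proj₁ nth-τ*w ⟩
      nth n w              ≡⟨ nth-tmPrefix (suc (2 * n)) n<2n+1 ⟩
      thueMorse n          ∎

    odd : thueMorse (suc (2 * n)) ≡ 5 ∸ thueMorse n
    odd = begin
      thueMorse (suc (2 * n))    ≡⟨ nth-tmPrefix (suc (suc (2 * n))) (n<1+n _) ⟨
      nth (suc (2 * n)) (τ* w)   ≡⟨ proj₂ nth-τ*w ⟩
      5 ∸ nth n w                ≡⟨ cong (5 ∸_) (nth-tmPrefix (suc (2 * n)) n<2n+1) ⟩
      5 ∸ thueMorse n            ∎

  2or3-product : ∀ {x} → Is2or3 x → x * (5 ∸ x) ≡ 6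
  2or3-product (inj₁ refl) = refl
  2or3-product (inj₂ refl) = refl

  thueMorse-pair-product : ∀ n → thueMorse (2 * n) * thueMorse (suc (2 * n)) ≡ 6
  thueMorse-pair-product n =
    trans (cong₂ _*_ (proj₁ (thueMorse-doubling n)) (proj₂ (thueMorse-doubling n)))
          (2or3-product (thueMorse-2or3 n))

  2or3-nonZero : ∀ {x} → Is2or3 x → NonZero x
  2or3-nonZero (inj₁ refl) = _
  2or3-nonZero (inj₂ refl) = _

  thueMorse-nonZero : ∀ n → NonZero (thueMorse n)
  thueMorse-nonZero n = 2or3-nonZero (thueMorse-2or3 n)

  h-inverse : ∀ {b z p x y} → Is2or3 b → p ≡ 5 ∸ b → IsDivMod z p x y → (x , y) ≡ h b z
  h-inverse (inj₁ refl) refl = divMod-unique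
  h-inverse (inj₂ refl) refl = divMod-unique

module OrderedField (F : CompleteOrderedField) where

  open import Algebra.Bundles using (CommutativeRing)
  open import Algebra.Structures using (module IsCommutativeRing)
  open import Relation.Binary.Structures using (module IsTotalOrder)
  open import Relation.Binary.Bundles using (Poset)
  import Relation.Binary.Reasoning.PartialOrder as PartialOrderReasoning
  open import Relation.Nullary using (¬_; contradiction)
  import Data.Nat.Properties as ℕ

  open CompleteOrderedField F
  open IsCommutativeRing isCommutativeRing
    using (+-assoc; +-comm; +-identityˡ; +-identityʳ; -‿inverseˡ; -‿inverseʳ;
           *-assoc; *-comm; *-identityˡ; *-identityʳ; distribʳ)
  open IsTotalOrder isTotalOrder using (total; antisym) renaming (refl to ≤-refl; trans to ≤-trans)

  commutativeRing : CommutativeRing _ _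
  commutativeRing = record { isCommutativeRing = isCommutativeRing }

  poset : Poset _ _ _
  poset = record { isPartialOrder = IsTotalOrder.isPartialOrder isTotalOrder }

  module ≤-Reasoning = PartialOrderReasoning poset

  open import Algebra.Properties.Ring (CommutativeRing.ring commutativeRing)
    using (-1*x≈-x; -‿involutive; -‿distribʳ-*)
  open import Algebra.Properties.Semiring.Mult (CommutativeRing.semiring commutativeRing)
    using (×-homo-+; ×1-homo-*) renaming (_×_ to _×′_)

  +-monoʳ-≤ : ∀ z {x y} → x ≤ y → z + x ≤ z + y
  +-monoʳ-≤ z {x} {y} x≤y = subst₂ _≤_ (+-comm x z) (+-comm y z) (+-mono-≤ x y z x≤y)

  x≤x+y : ∀ x {y} → 0# ≤ y → x ≤ x + y
  x≤x+y x 0≤y = subst (_≤ x + _) (+-identityʳ x) (+-monoʳ-≤ x 0≤y)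

  x≤0⇒0≤-x : ∀ {x} → x ≤ 0# → 0# ≤ - x
  x≤0⇒0≤-x {x} x≤0 = subst₂ _≤_ (-‿inverseʳ x) (+-identityˡ (- x)) (+-mono-≤ x 0# (- x) x≤0)

  0≤1 : 0# ≤ 1#
  0≤1 with total 0# 1#
  ... | inj₁ 0≤1 = 0≤1
  ... | inj₂ 1≤0 = subst (0# ≤_) -1*-1≡1 (*-nonneg _ _ (x≤0⇒0≤-x 1≤0) (x≤0⇒0≤-x 1≤0))
    where
    -1*-1≡1 : - 1# * - 1# ≡ 1#
    -1*-1≡1 = trans (-1*x≈-x (- 1#)) (-‿involutive 1#)

  0≰-1 : ¬ (0# ≤ - 1#)
  0≰-1 0≤-1 = 0≢1 (antisym 0≤1 (subst₂ _≤_ (+-identityˡ 1#) (-‿inverseˡ 1#) (+-mono-≤ 0# (- 1#) 1# 0≤-1)))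

  ⁻¹-nonneg : ∀ {x} → 0# ≤ x → x ≢ 0# → 0# ≤ x ⁻¹
  ⁻¹-nonneg {x} 0≤x x≢0 with total 0# (x ⁻¹)
  ... | inj₁ 0≤x⁻¹ = 0≤x⁻¹
  ... | inj₂ x⁻¹≤0 = contradiction (subst (0# ≤_) x*-x⁻¹≡-1 (*-nonneg _ _ 0≤x (x≤0⇒0≤-x x⁻¹≤0))) 0≰-1
    where
    x*-x⁻¹≡-1 : x * - (x ⁻¹) ≡ - 1#
    x*-x⁻¹≡-1 = trans (sym (-‿distribʳ-* x (x ⁻¹))) (cong -_ (⁻¹-inverse x x≢0))

  ⁻¹-unique : ∀ {x y z} → x * y ≡ 1# → x * z ≡ 1# → y ≡ z
  ⁻¹-unique {x} {y} {z} xy≡1 xz≡1 = begin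
    y              ≡⟨ *-identityʳ y ⟨
    y * 1#         ≡⟨ cong (y *_) xz≡1 ⟨
    y * (x * z)    ≡⟨ *-assoc y x z ⟨
    y * x * z      ≡⟨ cong (_* z) (trans (*-comm y x) xy≡1) ⟩
    1# * z         ≡⟨ *-identityˡ z ⟩
    z              ∎
    where open ≡-Reasoning

  ⁻¹-scale : ∀ {x y z} → x ≢ 0# → z ≢ 0# → x * y ≡ z → x ⁻¹ ≡ y * z ⁻¹
  ⁻¹-scale {x} {y} {z} x≢0 z≢0 xy≡z =
    ⁻¹-unique (⁻¹-inverse x x≢0) (trans (sym (*-assoc x y (z ⁻¹))) (trans (cong (_* z ⁻¹) xy≡z) (⁻¹-inverse z z≢0)))

  fromℕ≡×1 : ∀ n → fromℕ n ≡ n ×′ 1#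
  fromℕ≡×1 zero    = refl
  fromℕ≡×1 (suc n) = cong (1# +_) (fromℕ≡×1 n)

  fromℕ-+ : ∀ m n → fromℕ (m ℕ.+ n) ≡ fromℕ m + fromℕ n
  fromℕ-+ m n = trans (fromℕ≡×1 (m ℕ.+ n)) (trans (×-homo-+ 1# m n) (sym (cong₂ _+_ (fromℕ≡×1 m) (fromℕ≡×1 n))))

  fromℕ-* : ∀ m n → fromℕ (m ℕ.* n) ≡ fromℕ m * fromℕ n
  fromℕ-* m n = trans (fromℕ≡×1 (m ℕ.* n)) (trans (×1-homo-* m n) (sym (cong₂ _*_ (fromℕ≡×1 m) (fromℕ≡×1 n))))

  0≤fromℕ : ∀ n → 0# ≤ fromℕ n
  0≤fromℕ zero    = ≤-refl
  0≤fromℕ (suc n) = ≤-trans 0≤1 (x≤x+y 1# (0≤fromℕ n))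

  fromℕ≢0 : ∀ n .{{_ : NonZero n}} → fromℕ n ≢ 0#
  fromℕ≢0 (suc n) 1+n≡0 = 0≢1 (antisym 0≤1 (subst (1# ≤_) 1+n≡0 (x≤x+y 1# (0≤fromℕ n))))

  infixl 8 _//_

  _//_ : ℕ → ℕ → R
  m // q = fromℕ m * fromℕ q ⁻¹

  //-nonneg : ∀ m q .{{_ : NonZero q}} → 0# ≤ m // q
  //-nonneg m q = *-nonneg _ _ (0≤fromℕ m) (⁻¹-nonneg (0≤fromℕ q) (fromℕ≢0 q))

  //-+ : ∀ m n q → m // q + n // q ≡ (m ℕ.+ n) // q
  //-+ m n q = trans (sym (distribʳ (fromℕ q ⁻¹) (fromℕ m) (fromℕ n))) (cong (_* fromℕ q ⁻¹) (sym (fromℕ-+ m n)))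

  //-scale : ∀ m q p .{{_ : NonZero q}} .{{_ : NonZero p}} → m // q ≡ (m ℕ.* p) // (q ℕ.* p)
  //-scale m q p = begin
    fromℕ m * fromℕ q ⁻¹                        ≡⟨ cong (fromℕ m *_) q⁻¹≡p*[qp]⁻¹ ⟩
    fromℕ m * (fromℕ p * fromℕ (q ℕ.* p) ⁻¹)    ≡⟨ *-assoc _ _ _ ⟨
    fromℕ m * fromℕ p * fromℕ (q ℕ.* p) ⁻¹      ≡⟨ cong (_* _) (fromℕ-* m p) ⟨
    fromℕ (m ℕ.* p) * fromℕ (q ℕ.* p) ⁻¹        ∎
    where
    open ≡-Reasoning
    q⁻¹≡p*[qp]⁻¹ : fromℕ q ⁻¹ ≡ fromℕ p * fromℕ (q ℕ.* p) ⁻¹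
    q⁻¹≡p*[qp]⁻¹ = ⁻¹-scale (fromℕ≢0 q) (fromℕ≢0 (q ℕ.* p) {{ℕ.m*n≢0 q p}}) (sym (fromℕ-* q p))

  //-monoˡ-≤ : ∀ q .{{_ : NonZero q}} {m n} → m ℕ.≤ n → m // q ≤ n // q
  //-monoˡ-≤ q {m} {n} m≤n =
    subst (m // q ≤_) (trans (//-+ m (n ℕ.∸ m) q) (cong (_// q) (ℕ.m+[n∸m]≡n m≤n)))
          (x≤x+y (m // q) (//-nonneg (n ℕ.∸ m) q))

  +//-merge : ∀ s x y q p .{{_ : NonZero q}} .{{_ : NonZero p}} →
              s + x // q + y // (q ℕ.* p) ≡ s + (x ℕ.* p ℕ.+ y) // (q ℕ.* p)
  +//-merge s x y q p = begin
    s + x // q + y // (q ℕ.* p)                   ≡⟨ cong (λ t → s + t + y // (q ℕ.* p)) (//-scale x q p) ⟩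
    s + (x ℕ.* p) // (q ℕ.* p) + y // (q ℕ.* p)   ≡⟨ +-assoc s _ _ ⟩
    s + ((x ℕ.* p) // (q ℕ.* p) + y // (q ℕ.* p)) ≡⟨ cong (s +_) (//-+ (x ℕ.* p) y (q ℕ.* p)) ⟩
    s + (x ℕ.* p ℕ.+ y) // (q ℕ.* p)              ∎
    where open ≡-Reasoning

module GreedyExpansion (F : CompleteOrderedField) where

  open import Relation.Nullary using (yes; no)
  import Data.Nat.Properties as ℕ
  open BasesAndDigits using (IsDivMod; P-nonZero; P-grouped)
  open CompleteOrderedField F
  open OrderedField F using (module ≤-Reasoning; +-monoʳ-≤; _//_; //-scale; //-monoˡ-≤; +//-merge)

  -- IsGreedyExpansion F β r a unfolds to ∀ N → IsGreedyDigit r (partialSum F β a N) (P β N) (a N).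
  IsGreedyDigit : R → R → ℕ → ℕ → Set
  IsGreedyDigit r s q d = (s + d // q ≤ r) × (∀ m → s + m // q ≤ r → m ℕ.≤ d)

  greedyDigit-unique : ∀ {r s q d e} → IsGreedyDigit r s q d → IsGreedyDigit r s q e → d ≡ e
  greedyDigit-unique (d-fits , d-max) (e-fits , e-max) = ℕ.≤-antisym (e-max _ d-fits) (d-max _ e-fits)

  greedyDigit-pair : ∀ {r s q p x y} .{{_ : NonZero q}} .{{_ : NonZero p}} →
    IsGreedyDigit r s q x → IsGreedyDigit r (s + x // q) (q ℕ.* p) y →
    IsGreedyDigit r s (q ℕ.* p) (x ℕ.* p ℕ.+ y) × y ℕ.< p
  greedyDigit-pair {r} {s} {q} {p} {x} {y} (_ , x-max) (y-fits , y-max) = (fits , maximal) , y<p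
    where
    instance
      qp≢0 : NonZero (q ℕ.* p)
      qp≢0 = ℕ.m*n≢0 q p

    split : ∀ m → s + x // q + m // (q ℕ.* p) ≡ s + (x ℕ.* p ℕ.+ m) // (q ℕ.* p)
    split m = +//-merge s x m q p

    fits : s + (x ℕ.* p ℕ.+ y) // (q ℕ.* p) ≤ r
    fits = subst (_≤ r) (split y) y-fits

    maximal : ∀ m → s + m // (q ℕ.* p) ≤ r → m ℕ.≤ x ℕ.* p ℕ.+ y
    maximal m m-fits with x ℕ.* p ℕ.≤? m
    ... | no  xp≰m = ℕ.≤-trans (ℕ.<⇒≤ (ℕ.≰⇒> xp≰m)) (ℕ.m≤m+n _ y)
    ... | yes xp≤m = subst (ℕ._≤ x ℕ.* p ℕ.+ y) m≡xp+d (ℕ.+-monoʳ-≤ (x ℕ.* p) (y-max d d-fits))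
      where
      d : ℕ
      d = m ℕ.∸ x ℕ.* p
      m≡xp+d : x ℕ.* p ℕ.+ d ≡ m
      m≡xp+d = ℕ.m+[n∸m]≡n xp≤m
      d-fits : s + x // q + d // (q ℕ.* p) ≤ r
      d-fits = subst (_≤ r) (sym (trans (split d) (cong (λ k → s + k // (q ℕ.* p)) m≡xp+d))) m-fits

    y<p : y ℕ.< p
    y<p = ℕ.≰⇒> λ p≤y → ℕ.1+n≰n (x-max (suc x) (begin
      s + suc x // q                 ≡⟨ cong (s +_) (//-scale (suc x) q p) ⟩
      s + (p ℕ.+ x ℕ.* p) // (q ℕ.* p) ≡⟨ cong (λ k → s + k // (q ℕ.* p)) (ℕ.+-comm p (x ℕ.* p)) ⟩
      s + (x ℕ.* p ℕ.+ p) // (q ℕ.* p) ≡⟨ split p ⟨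
      s + x // q + p // (q ℕ.* p)    ≤⟨ +-monoʳ-≤ _ (//-monoˡ-≤ (q ℕ.* p) p≤y) ⟩
      s + x // q + y // (q ℕ.* p)    ≤⟨ y-fits ⟩
      r                              ∎))
      where open ≤-Reasoning

  greedy-grouping : ∀ {β γ} → (∀ n → NonZero (β n)) →
    (∀ n → β (2 ℕ.* n) ℕ.* β (suc (2 ℕ.* n)) ≡ γ n) →
    ∀ {r a c} → IsGreedyExpansion F γ r c → IsGreedyExpansion F β r a →
    ∀ n → IsDivMod (c n) (β (suc (2 ℕ.* n))) (a (2 ℕ.* n)) (a (suc (2 ℕ.* n)))
  greedy-grouping {β} {γ} β≢0 pairs {r} {a} {c} c-greedy a-greedy n = block n (partialSum-grouped n)
    where
    digits : ℕ → ℕ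
    digits n = a (2 ℕ.* n) ℕ.* β (suc (2 ℕ.* n)) ℕ.+ a (suc (2 ℕ.* n))

    block : ∀ n → partialSum F β a (2 ℕ.* n) ≡ partialSum F γ c n →
            IsDivMod (c n) (β (suc (2 ℕ.* n))) (a (2 ℕ.* n)) (a (suc (2 ℕ.* n)))
    block n sums≡ =
      greedyDigit-unique {s = partialSum F γ c n} {q = P γ n}
        (subst₂ (λ s q → IsGreedyDigit r s q (digits n)) sums≡ (P-grouped pairs n) (proj₁ pair)) (c-greedy n) ,
      proj₂ pair
      where
      instance
        q≢0 : NonZero (P β (2 ℕ.* n))
        q≢0 = P-nonZero β≢0 (2 ℕ.* n)
        p≢0 : NonZero (β (suc (2 ℕ.* n)))
        p≢0 = β≢0 (suc (2 ℕ.* n))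
      pair : IsGreedyDigit r (partialSum F β a (2 ℕ.* n)) (P β (suc (2 ℕ.* n))) (digits n) ×
             a (suc (2 ℕ.* n)) ℕ.< β (suc (2 ℕ.* n))
      pair = greedyDigit-pair (a-greedy (2 ℕ.* n)) (a-greedy (suc (2 ℕ.* n)))

    partialSum-grouped : ∀ n → partialSum F β a (2 ℕ.* n) ≡ partialSum F γ c n
    partialSum-grouped zero    = refl
    partialSum-grouped (suc n) = begin
      partialSum F β a (2 ℕ.* suc n)                                   ≡⟨ cong (partialSum F β a) (ℕ.*-suc 2 n) ⟩
      s + a (2 ℕ.* n) // P β (2 ℕ.* n) + a (suc (2 ℕ.* n)) // P β (suc (2 ℕ.* n))
        ≡⟨ +//-merge s (a (2 ℕ.* n)) (a (suc (2 ℕ.* n))) (P β (2 ℕ.* n)) (β (suc (2 ℕ.* n))) ⟩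
      s + digits n // P β (suc (2 ℕ.* n))                              ≡⟨ cong₂ (λ t k → t + k // P β (suc (2 ℕ.* n))) ih (proj₁ (block n ih)) ⟩
      partialSum F γ c n + c n // P β (suc (2 ℕ.* n))                  ≡⟨ cong (λ q → partialSum F γ c n + c n // q) (P-grouped pairs n) ⟩
      partialSum F γ c n + c n // P γ n                                ∎
      where
      open ≡-Reasoning
      instance
        q≢0 : NonZero (P β (2 ℕ.* n))
        q≢0 = P-nonZero β≢0 (2 ℕ.* n)
        p≢0 : NonZero (β (suc (2 ℕ.* n)))
        p≢0 = β≢0 (suc (2 ℕ.* n))
      s : R
      s = partialSum F β a (2 ℕ.* n)
      ih : partialSum F β a (2 ℕ.* n) ≡ partialSum F γ c n
      ih = partialSum-grouped n

open import Data.Nat using (_*_)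
open ThueMorse using (thueMorse-2or3; thueMorse-doubling; thueMorse-nonZero; thueMorse-pair-product; h-inverse)
open GreedyExpansion using (greedy-grouping)

theorem2p2 : (F : CompleteOrderedField) → (r : CompleteOrderedField.R F) →
    CompleteOrderedField._≤_ F (CompleteOrderedField.0# F) r →
    CompleteOrderedField._<_ F r (CompleteOrderedField.1# F) →
    (c a : ℕ → ℕ) →
    IsGreedyExpansion F six r c →
    IsGreedyExpansion F thueMorse r a →
    ∀ n → (a (2 * n) , a (suc (2 * n))) ≡ h (thueMorse n) (c n)
theorem2p2 F r _ _ c a c-greedy a-greedy n =
  h-inverse (thueMorse-2or3 n) (proj₂ (thueMorse-doubling n))
    (greedy-grouping F thueMorse-nonZero thueMorse-pair-product c-greedy a-greedy n)
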